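{- Let $k\geq 1$ be an integer, let $G$ be a $C_{2k+1}$-free graph and let $C$ be a cycle of odd length $2\ell+1$ in $G$. If $\ell\geq k+1$, then $\deg(x,C)\leq \ell$ for every $x\in V(G)\setminus V(C)$.
   Context: All graphs are finite and simple. $G$ is $C_{2k+1}$-free if it contains no cycle of length $2k+1$ as a subgraph. For a vertex $x$ and a subgraph $C$, $\deg(x,C)$ denotes the number of neighbors of $x$ in $V(C)$. -}

module Defs where

open import Data.Nat using (ℕ; zero; suc; _+_; _*_)
open import Data.Fin using (Fin; zero; suc; toℕ; fromℕ<; fromℕ; inject₁)
open import Data.Fin.Properties using (_≟_)
open import Data.Bool using (Bool; true; false)
open import Data.List using (List; length; filterᵇ; allFin)
open import Data.Product using (Σ; _×_; _,_)
open import Relation.Binary.PropositionalEquality using (_≡_)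
open import Relation.Nullary using (¬_)
open import Function.Definitions using (Injective)

record Graph (n : ℕ) : Set where
  field
    adj   : Fin n → Fin n → Bool
    sym   : ∀ u v → adj u v ≡ adj v u
    irrfl : ∀ v → adj v v ≡ false
open Graph public

next : ∀ {m} → Fin m → Fin m
next {suc m} i with toℕ i Data.Nat.<? m
... | Relation.Nullary.yes p = suc (fromℕ< p)
... | Relation.Nullary.no _ = zero
  where open import Data.Nat using (_<?_)

record Cycle {n : ℕ} (G : Graph n) (m : ℕ) : Set where
  field
    vtx      : Fin m → Fin n
    length≥3 : 3 Data.Nat.≤ m
    inj      : Injective _≡_ _≡_ vtx
    edges    : ∀ i → adj G (vtx i) (vtx (next i)) ≡ true
open Cycle public

HasCycle : ∀ {n} → Graph n → ℕ → Set
HasCycle G m = Cycle G m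

CycleFree : ∀ {n} → Graph n → ℕ → Set
CycleFree G m = ¬ HasCycle G m

_∈V_ : ∀ {n} {G : Graph n} {m} → Fin n → Cycle G m → Set
x ∈V C = Σ _ λ i → vtx C i ≡ x

-- deg(x, C): number of neighbours of x among the vertices of C
-- (C injective, so counting indices counts vertices)
deg : ∀ {n} {G : Graph n} {m} → Fin n → Cycle G m → ℕ
deg {G = G} x C = length (filterᵇ (λ i → adj G x (vtx C i)) (allFin _))

-- If x is adjacent to two vertices v_i and v_(i+s) of C with 1 ≤ s < |C|, then
-- x v_i v_(i+1) … v_(i+s) x is a cycle of length s + 2. For s = 2k − 1 this is
-- excluded, so for every i at most one of v_i, v_(i+s) is a neighbour of x.
-- Summing over all i counts every neighbour twice: 2 deg(x, C) ≤ 2ℓ + 1.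
module Submission where

open import Defs hiding (sym)
open import Data.Nat using (ℕ; zero; suc; _+_; _*_; _∸_; _≤_; _<_; _%_; z≤n; s≤s; s≤s⁻¹; z<s; _<?_; NonZero; >-nonZero)
open import Data.Nat.Properties
open import Data.Nat.DivMod using (_mod_; %-distribˡ-+; m<n⇒m%n≡m; m≤n⇒[n∸m]%m≡n%m; m%n≤m; m%n%n≡m%n; [m+n]%n≡m%n; n%n≡0)
open import Data.Nat.Tactic.RingSolver using (solve-∀)
open import Algebra.Properties.CommutativeSemigroup +-commutativeSemigroup using (interchange)
open import Data.Fin using (Fin; zero; suc; toℕ)
open import Data.Fin.Properties using (toℕ-injective; toℕ-fromℕ<; toℕ<n)
open import Data.Bool using (Bool; true; false)
open import Data.List using (length; filterᵇ; tabulate)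
open import Data.Product using (_×_; _,_)
open import Data.Sum using (_⊎_; inj₁; inj₂; [_,_]′)
open import Data.Empty using (⊥; ⊥-elim)
open import Relation.Nullary using (¬_; yes; no; contradiction)
open import Relation.Binary.PropositionalEquality
open import Function using (id; _∘_; _$_)

χ : Bool → ℕ
χ true  = 1
χ false = 0

χ+χ≤1 : ∀ {a b} → (a ≡ true → b ≡ true → ⊥) → χ a + χ b ≤ 1
χ+χ≤1 {true}  {true}  not-both = contradiction refl (not-both refl)
χ+χ≤1 {true}  {false} _        = ≤-refl
χ+χ≤1 {false} {true}  _        = ≤-refl
χ+χ≤1 {false} {false} _        = z≤n

∑ : ℕ → (ℕ → ℕ) → ℕ
∑ zero    f = 0
∑ (suc n) f = f 0 + ∑ n (f ∘ suc)

syntax ∑ n (λ t → e) = ∑[ t < n ] e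

∑-cong : ∀ n {f g : ℕ → ℕ} → (∀ t → f t ≡ g t) → ∑ n f ≡ ∑ n g
∑-cong zero    f≗g = refl
∑-cong (suc n) f≗g = cong₂ _+_ (f≗g 0) (∑-cong n (f≗g ∘ suc))

∑-init-last : ∀ n (f : ℕ → ℕ) → ∑ (suc n) f ≡ ∑ n f + f n
∑-init-last zero    f = +-comm (f 0) 0
∑-init-last (suc n) f = begin
  f 0 + ∑ (suc n) (f ∘ suc)          ≡⟨ cong (f 0 +_) (∑-init-last n (f ∘ suc)) ⟩
  f 0 + (∑ n (f ∘ suc) + f (suc n))  ≡⟨ +-assoc (f 0) _ _ ⟨
  ∑ (suc n) f + f (suc n)            ∎
  where open ≡-Reasoning

∑-distrib-+ : ∀ n (f g : ℕ → ℕ) → ∑[ t < n ] (f t + g t) ≡ ∑ n f + ∑ n g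
∑-distrib-+ zero    f g = refl
∑-distrib-+ (suc n) f g = begin
  f 0 + g 0 + ∑[ t < n ] (f (suc t) + g (suc t))
    ≡⟨ cong (f 0 + g 0 +_) (∑-distrib-+ n (f ∘ suc) (g ∘ suc)) ⟩
  f 0 + g 0 + (∑ n (f ∘ suc) + ∑ n (g ∘ suc))
    ≡⟨ interchange (f 0) (g 0) _ _ ⟩
  ∑ (suc n) f + ∑ (suc n) g
    ∎
  where open ≡-Reasoning

∑-bounded : ∀ n {f : ℕ → ℕ} {c} → (∀ t → t < n → f t ≤ c) → ∑ n f ≤ n * c
∑-bounded zero    f≤c = z≤n
∑-bounded (suc n) f≤c = +-mono-≤ (f≤c 0 z<s) (∑-bounded n (λ t t<n → f≤c (suc t) (s≤s t<n)))

∑-rotate : ∀ n (f : ℕ → ℕ) → f n ≡ f 0 → ∑[ t < n ] f (suc t) ≡ ∑ n f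
∑-rotate n f fn≡f0 = +-cancelˡ-≡ (f 0) _ _ (begin
  ∑ (suc n) f    ≡⟨ ∑-init-last n f ⟩
  ∑ n f + f n    ≡⟨ cong (∑ n f +_) fn≡f0 ⟩
  ∑ n f + f 0    ≡⟨ +-comm (∑ n f) (f 0) ⟩
  f 0 + ∑ n f    ∎)
  where open ≡-Reasoning

∑-periodic-shift : ∀ n (f : ℕ → ℕ) → (∀ t → f (t + n) ≡ f t) →
                   ∀ s → ∑[ t < n ] f (t + s) ≡ ∑ n f
∑-periodic-shift n f periodic zero    = ∑-cong n (cong f ∘ +-identityʳ)
∑-periodic-shift n f periodic (suc s) = begin
  ∑[ t < n ] f (t + suc s)  ≡⟨ ∑-cong n (λ t → cong f (+-suc t s)) ⟩
  ∑[ t < n ] f (suc t + s)  ≡⟨ ∑-rotate n (f ∘ (_+ s)) (trans (cong f (+-comm n s)) (periodic s)) ⟩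
  ∑[ t < n ] f (t + s)      ≡⟨ ∑-periodic-shift n f periodic s ⟩
  ∑ n f                     ∎
  where open ≡-Reasoning

length-filterᵇ-tabulate : ∀ {A : Set} (p : A → Bool) n (f : Fin n → A) (g : ℕ → Bool) →
                          (∀ j → p (f j) ≡ g (toℕ j)) →
                          length (filterᵇ p (tabulate f)) ≡ ∑[ t < n ] χ (g t)
length-filterᵇ-tabulate p zero    f g p≡g = refl
length-filterᵇ-tabulate p (suc n) f g p≡g rewrite p≡g zero with g 0
... | true  = cong suc (length-filterᵇ-tabulate p n (f ∘ suc) (g ∘ suc) (p≡g ∘ suc))
... | false = length-filterᵇ-tabulate p n (f ∘ suc) (g ∘ suc) (p≡g ∘ suc)

[m+n]%o≡m%o⇒n≡0 : ∀ m {n o} .{{_ : NonZero o}} → n < o → (m + n) % o ≡ m % o → n ≡ 0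
[m+n]%o≡m%o⇒n≡0 m {n} {o} n<o eq = [ small , ⊥-elim ∘ large ]′ (<-≤-connex (r + n) o)
  where
  r : ℕ
  r = m % o
  reduced : (r + n) % o ≡ r
  reduced = begin
    (r + n) % o      ≡⟨ cong (λ k → (r + k) % o) (m<n⇒m%n≡m n<o) ⟨
    (r + n % o) % o  ≡⟨ %-distribˡ-+ m n o ⟨
    (m + n) % o      ≡⟨ eq ⟩
    r                ∎
    where open ≡-Reasoning
  small : r + n < o → n ≡ 0
  small r+n<o = +-cancelˡ-≡ r n 0 (begin
    r + n        ≡⟨ m<n⇒m%n≡m r+n<o ⟨
    (r + n) % o  ≡⟨ reduced ⟩
    r            ≡⟨ +-identityʳ r ⟨
    r + 0        ∎)
    where open ≡-Reasoning
  large : ¬ o ≤ r + n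
  large o≤r+n = <-irrefl refl $ begin-strict
    r                ≡⟨ reduced ⟨
    (r + n) % o      ≡⟨ m≤n⇒[n∸m]%m≡n%m o≤r+n ⟨
    (r + n ∸ o) % o  ≤⟨ m%n≤m (r + n ∸ o) o ⟩
    r + n ∸ o        <⟨ ∸-monoˡ-< (+-monoʳ-< r n<o) o≤r+n ⟩
    r + o ∸ o        ≡⟨ m+n∸n≡m r o ⟩
    r                ∎
    where open ≤-Reasoning

[m+n]%o≡[m+p]%o⇒n≡p : ∀ m {n p o} .{{_ : NonZero o}} → n < o → p < o →
                      (m + n) % o ≡ (m + p) % o → n ≡ p
[m+n]%o≡[m+p]%o⇒n≡p m {n} {p} {o} n<o p<o eq =
  [ (λ n≤p → ordered n≤p p<o eq) , (λ p≤n → sym (ordered p≤n n<o (sym eq))) ]′ (≤-total n p)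
  where
  ordered : ∀ {a b} → a ≤ b → b < o → (m + a) % o ≡ (m + b) % o → a ≡ b
  ordered {a} {b} a≤b b<o eq = ≤-antisym a≤b (m∸n≡0⇒m≤n (
    [m+n]%o≡m%o⇒n≡0 (m + a) (≤-<-trans (m∸n≤m b a) b<o) (begin
      (m + a + (b ∸ a)) % o    ≡⟨ cong (_% o) (+-assoc m a (b ∸ a)) ⟩
      (m + (a + (b ∸ a))) % o  ≡⟨ cong (λ k → (m + k) % o) (m+[n∸m]≡n a≤b) ⟩
      (m + b) % o              ≡⟨ eq ⟨
      (m + a) % o              ∎)))
    where open ≡-Reasoning

[1+m%n]%n≡[1+m]%n : ∀ m n .{{_ : NonZero n}} → suc (m % n) % n ≡ suc m % n
[1+m%n]%n≡[1+m]%n m n = begin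
  (1 + m % n) % n          ≡⟨ %-distribˡ-+ 1 (m % n) n ⟩
  (1 % n + m % n % n) % n  ≡⟨ cong (λ k → (1 % n + k) % n) (m%n%n≡m%n m n) ⟩
  (1 % n + m % n) % n      ≡⟨ %-distribˡ-+ 1 m n ⟨
  (1 + m) % n              ∎
  where open ≡-Reasoning

next-cases : ∀ {M} (j : Fin (suc M)) →
             toℕ j < M × toℕ (next j) ≡ suc (toℕ j) ⊎ toℕ j ≡ M × next j ≡ zero
next-cases {M} j with toℕ j <? M
... | yes j<M = inj₁ (j<M , cong suc (toℕ-fromℕ< j<M))
... | no  j≮M = inj₂ (≤∧≮⇒≡ (s≤s⁻¹ (toℕ<n j)) j≮M , refl)

toℕ-next : ∀ {M} (j : Fin (suc M)) → toℕ (next j) ≡ suc (toℕ j) % suc M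
toℕ-next {M} j with next-cases j
... | inj₁ (j<M , next≡) = trans next≡ (sym (m<n⇒m%n≡m (s≤s j<M)))
... | inj₂ (j≡M , next≡) = begin
  toℕ (next j)         ≡⟨ cong toℕ next≡ ⟩
  0                    ≡⟨ n%n≡0 (suc M) ⟨
  suc M % suc M        ≡⟨ cong (λ k → suc k % suc M) j≡M ⟨
  suc (toℕ j) % suc M  ∎
  where open ≡-Reasoning

toℕ-mod : ∀ t m .{{_ : NonZero m}} → toℕ (t mod m) ≡ t % m
toℕ-mod t m = toℕ-fromℕ< _

next-mod : ∀ t {m} .{{_ : NonZero m}} → next (t mod m) ≡ suc t mod m
next-mod t {m@(suc _)} = toℕ-injective (begin
  toℕ (next (t mod m))     ≡⟨ toℕ-next (t mod m) ⟩
  suc (toℕ (t mod m)) % m  ≡⟨ cong (λ k → suc k % m) (toℕ-mod t m) ⟩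
  suc (t % m) % m          ≡⟨ [1+m%n]%n≡[1+m]%n t m ⟩
  suc t % m                ≡⟨ toℕ-mod (suc t) m ⟨
  toℕ (suc t mod m)        ∎)
  where open ≡-Reasoning

close-path : ∀ {n} {G : Graph n} L (w : ℕ → Fin n) → 2 ≤ L →
             (∀ {p q} → p ≤ L → q ≤ L → w p ≡ w q → p ≡ q) →
             (∀ t → t < L → adj G (w t) (w (suc t)) ≡ true) →
             adj G (w L) (w 0) ≡ true →
             Cycle G (suc L)
close-path {n} {G} L w 2≤L w-injective w-adj w-closing = record
  { vtx      = w ∘ toℕ
  ; length≥3 = s≤s 2≤L
  ; inj      = λ e → toℕ-injective (w-injective (toℕ≤L _) (toℕ≤L _) e)
  ; edges    = edge
  }
  where
  _∼_ : Fin n → Fin n → Set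
  u ∼ v = adj G u v ≡ true
  toℕ≤L : (j : Fin (suc L)) → toℕ j ≤ L
  toℕ≤L j = s≤s⁻¹ (toℕ<n j)
  edge : ∀ j → adj G (w (toℕ j)) (w (toℕ (next j))) ≡ true
  edge j with next-cases j
  ... | inj₁ (j<L , next≡) = subst (λ v → w (toℕ j) ∼ w v) (sym next≡) (w-adj (toℕ j) j<L)
  ... | inj₂ (j≡L , next≡) = subst₂ (λ u v → w u ∼ w v) (sym j≡L) (cong toℕ (sym next≡)) w-closing

-- C read as an m-periodic sequence indexed by ℕ, so that arcs never wrap around.
module Traversal {n} {G : Graph n} {m} (C : Cycle G m) where

  instance
    length-nonZero : NonZero m
    length-nonZero = >-nonZero (<-≤-trans z<s (length≥3 C))

  at : ℕ → Fin n
  at t = vtx C (t mod m)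

  at∈V : ∀ t → at t ∈V C
  at∈V t = t mod m , refl

  at-toℕ : ∀ j → at (toℕ j) ≡ vtx C j
  at-toℕ j = cong (vtx C) (toℕ-injective (trans (toℕ-mod (toℕ j) m) (m<n⇒m%n≡m (toℕ<n j))))

  at-periodic : ∀ t → at (t + m) ≡ at t
  at-periodic t = cong (vtx C) (toℕ-injective (begin
    toℕ ((t + m) mod m)  ≡⟨ toℕ-mod (t + m) m ⟩
    (t + m) % m          ≡⟨ [m+n]%n≡m%n t m ⟩
    t % m                ≡⟨ toℕ-mod t m ⟨
    toℕ (t mod m)        ∎))
    where open ≡-Reasoning

  at-adj-suc : ∀ t → adj G (at t) (at (suc t)) ≡ true
  at-adj-suc t = subst (λ j → adj G (at t) (vtx C j) ≡ true) (next-mod t) (edges C (t mod m))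

  at-injective-on-arcs : ∀ i {p q} → p < m → q < m → at (i + p) ≡ at (i + q) → p ≡ q
  at-injective-on-arcs i {p} {q} p<m q<m e = [m+n]%o≡[m+p]%o⇒n≡p i p<m q<m (begin
    (i + p) % m          ≡⟨ toℕ-mod (i + p) m ⟨
    toℕ ((i + p) mod m)  ≡⟨ cong toℕ (inj C e) ⟩
    toℕ ((i + q) mod m)  ≡⟨ toℕ-mod (i + q) m ⟩
    (i + q) % m          ∎)
    where open ≡-Reasoning

module _ {n} {G : Graph n} {m} (C : Cycle G m) {x : Fin n} (x∉C : ¬ x ∈V C) where

  open Traversal C

  cycle-through-neighbours : ∀ {s} i → 1 ≤ s → s < m →
                             adj G x (at i) ≡ true → adj G x (at (i + s)) ≡ true →
                             Cycle G (2 + s)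
  cycle-through-neighbours {s} i 1≤s s<m x∼i x∼i+s =
    close-path (suc s) w (s≤s 1≤s) w-injective w-adj w-closing
    where
    w : ℕ → Fin n
    w zero    = x
    w (suc t) = at (i + t)

    w-injective : ∀ {p q} → p ≤ suc s → q ≤ suc s → w p ≡ w q → p ≡ q
    w-injective {zero}  {zero}  _   _   _ = refl
    w-injective {zero}  {suc q} _   _   e = contradiction (subst (_∈V C) (sym e) (at∈V (i + q))) x∉C
    w-injective {suc p} {zero}  _   _   e = contradiction (subst (_∈V C) e (at∈V (i + p))) x∉C
    w-injective {suc p} {suc q} p<2+s q<2+s e =
      cong suc (at-injective-on-arcs i (≤-<-trans (s≤s⁻¹ p<2+s) s<m) (≤-<-trans (s≤s⁻¹ q<2+s) s<m) e)

    w-adj : ∀ t → t < suc s → adj G (w t) (w (suc t)) ≡ true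
    w-adj zero    _ = subst (λ j → adj G x (at j) ≡ true) (sym (+-identityʳ i)) x∼i
    w-adj (suc t) _ = subst (λ j → adj G (at (i + t)) (at j) ≡ true) (sym (+-suc i t))
                            (at-adj-suc (i + t))

    w-closing : adj G (at (i + s)) x ≡ true
    w-closing = trans (Graph.sym G _ _) x∼i+s

  deg≡∑ : deg x C ≡ ∑[ t < m ] χ (adj G x (at t))
  deg≡∑ = length-filterᵇ-tabulate (λ j → adj G x (vtx C j)) m id (λ t → adj G x (at t))
            (λ j → cong (adj G x) (sym (at-toℕ j)))

  2*deg≤length : ∀ {s} → 1 ≤ s → s < m → CycleFree G (2 + s) → 2 * deg x C ≤ m
  2*deg≤length {s} 1≤s s<m free = begin
    2 * deg x C                     ≡⟨ cong (deg x C +_) (+-identityʳ (deg x C)) ⟩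
    deg x C + deg x C               ≡⟨ cong₂ _+_ deg≡∑ deg≡∑ ⟩
    ∑ m a + ∑ m a                   ≡⟨ cong (∑ m a +_) (∑-periodic-shift m a a-periodic s) ⟨
    ∑ m a + ∑[ t < m ] a (t + s)    ≡⟨ ∑-distrib-+ m a (λ t → a (t + s)) ⟨
    ∑[ t < m ] (a t + a (t + s))    ≤⟨ ∑-bounded m (λ t _ → at-most-one-of t) ⟩
    m * 1                           ≡⟨ *-identityʳ m ⟩
    m                               ∎
    where
    open ≤-Reasoning
    a : ℕ → ℕ
    a t = χ (adj G x (at t))
    a-periodic : ∀ t → a (t + m) ≡ a t
    a-periodic t = cong (χ ∘ adj G x) (at-periodic t)
    at-most-one-of : ∀ t → a t + a (t + s) ≤ 1
    at-most-one-of t = χ+χ≤1 λ x∼t x∼t+s →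
      free (cycle-through-neighbours t 1≤s s<m x∼t x∼t+s)

2*m≤2*n+1⇒m≤n : ∀ {m n} → 2 * m ≤ 2 * n + 1 → m ≤ n
2*m≤2*n+1⇒m≤n {m} {n} 2m≤2n+1 = s≤s⁻¹ (*-cancelˡ-< 2 m (suc n) (begin-strict
  2 * m        ≤⟨ 2m≤2n+1 ⟩
  2 * n + 1    ≡⟨ +-comm (2 * n) 1 ⟩
  1 + 2 * n    <⟨ n<1+n (1 + 2 * n) ⟩
  2 + 2 * n    ≡⟨ *-suc 2 n ⟨
  2 * suc n    ∎))
  where open ≤-Reasoning

fact2p3 : (k ℓ : ℕ) → 1 ≤ k → {n : ℕ} → (G : Graph n) → CycleFree G (2 * k + 1) →
          (C : Cycle G (2 * ℓ + 1)) → k + 1 ≤ ℓ →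
          (x : Fin n) → ¬ (x ∈V C) → deg x C ≤ ℓ
fact2p3 zero      ℓ ()
fact2p3 (suc k-1) ℓ _ G free C k+1≤ℓ x x∉C =
  2*m≤2*n+1⇒m≤n (2*deg≤length C x∉C (s≤s z≤n) s<2ℓ+1 (free ∘ subst (Cycle G) (2+[1+2j]≡2[1+j]+1 k-1)))
  where
  s : ℕ
  s = 1 + 2 * k-1
  2+[1+2j]≡2[1+j]+1 : ∀ j → 2 + (1 + 2 * j) ≡ 2 * suc j + 1
  2+[1+2j]≡2[1+j]+1 = solve-∀
  s<2ℓ+1 : s < 2 * ℓ + 1
  s<2ℓ+1 = subst (s <_) (+-comm 1 (2 * ℓ)) (s≤s (*-monoʳ-< 2 k-1<ℓ))
    where
    k-1<ℓ : k-1 < ℓ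
    k-1<ℓ = ≤-trans (m≤m+n (suc k-1) 1) k+1≤ℓ
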